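{- Let $\Phi\in\mathbb{Z}[x,y]$ be a binary form. Suppose there exists an integer $l$ with $1\le l<\deg\Phi$ such that the linear span of $\{\Phi^{u,v}:u+v=l\}$ is one-dimensional. Then $\Phi$ is degenerate.
   Context: $\Phi^{u,v}=\frac{\partial^{u+v}}{\partial x^u\partial y^v}\Phi(x,y)$ for integers $u,v\ge0$. A binary form $\Phi$ of degree $k$ is degenerate if $\Phi=(\alpha x+\beta y)^k$ for some $\alpha,\beta\in\mathbb{C}$. -}

module Defs where

open import Level using (Level; _⊔_) renaming (suc to lsuc)
open import Algebra.Bundles using (CommutativeRing)
open import Data.Nat as ℕ using (ℕ; zero; suc; _≤_; _<_; _∸_)
open import Data.Integer as ℤ using (ℤ; +_; -[1+_])
open import Data.Fin using (Fin; toℕ)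
open import Data.Product using (Σ; ∃; _×_)
open import Relation.Binary.PropositionalEquality using (_≡_)
open import Relation.Nullary using (¬_)

-- An algebraically closed field of characteristic 0 (ℂ is the model the
-- paper has in mind; the standard library has no ℂ).

module FieldOps {c ℓ : Level} (R : CommutativeRing c ℓ) where
  open CommutativeRing R using (Carrier; _≈_; _+_; _*_; -_; 0#; 1#)

  fromℕ : ℕ → Carrier
  fromℕ zero    = 0#
  fromℕ (suc n) = 1# + fromℕ n

  fromℤ : ℤ → Carrier
  fromℤ (+ n)      = fromℕ n
  fromℤ -[1+ n ]   = - fromℕ (suc n)

  pow : Carrier → ℕ → Carrier
  pow x zero    = 1#
  pow x (suc n) = x * pow x n

  sumTo : ℕ → (ℕ → Carrier) → Carrier
  sumTo zero    f = f zero
  sumTo (suc n) f = sumTo n f + f (suc n)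

  sumFin : (n : ℕ) → (Fin n → Carrier) → Carrier
  sumFin zero    f = 0#
  sumFin (suc n) f = f Fin.zero + sumFin n (λ i → f (Fin.suc i))
    where import Data.Fin as Fin

record AlgClosedChar0 (c ℓ : Level) : Set (lsuc (c ⊔ ℓ)) where
  field
    ring : CommutativeRing c ℓ
  open CommutativeRing ring using (Carrier; _≈_; _+_; _*_; -_; 0#; 1#)
  open FieldOps ring
  field
    inverse      : ∀ x → ¬ (x ≈ 0#) → ∃ λ y → x * y ≈ 1#
    char0        : ∀ n → ¬ (fromℕ (suc n) ≈ 0#)
    algClosed    : ∀ n (a : Fin (suc n) → Carrier) →
                   ∃ λ z → pow z (suc n) + sumFin (suc n) (λ i → a i * pow z (toℕ i)) ≈ 0#

-- Polynomials in x, y over a ring, as coefficient functions: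
-- P i j = coefficient of x^i y^j.

module Poly {c ℓ : Level} (R : CommutativeRing c ℓ) where
  open CommutativeRing R using (Carrier; _≈_; _+_; _*_; -_; 0#; 1#)
  open FieldOps R public

  Poly : Set c
  Poly = ℕ → ℕ → Carrier

  _≋_ : Poly → Poly → Set ℓ
  P ≋ Q = ∀ i j → P i j ≈ Q i j

  zeroP : Poly
  zeroP i j = 0#

  NonZeroP : Poly → Set ℓ
  NonZeroP P = ¬ (P ≋ zeroP)

  scale : Carrier → Poly → Poly
  scale λ' P i j = λ' * P i j

  _+P_ : Poly → Poly → Poly
  (P +P Q) i j = P i j + Q i j

  _*P_ : Poly → Poly → Poly
  (P *P Q) i j = sumTo i (λ a → sumTo j (λ b → P a b * Q (i ∸ a) (j ∸ b)))

  oneP : Poly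
  oneP zero zero = 1#
  oneP _    _    = 0#

  powP : Poly → ℕ → Poly
  powP P zero    = oneP
  powP P (suc n) = P *P powP P n

  linear : Carrier → Carrier → Poly
  linear α β 1 0 = α
  linear α β 0 1 = β
  linear α β _ _ = 0#

  ∂x : Poly → Poly
  ∂x P i j = fromℕ (suc i) * P (suc i) j

  ∂y : Poly → Poly
  ∂y P i j = fromℕ (suc j) * P i (suc j)

  iter : ℕ → (Poly → Poly) → Poly → Poly
  iter zero    f P = P
  iter (suc n) f P = f (iter n f P)

  deriv : ℕ → ℕ → Poly → Poly
  deriv u v P = iter u ∂x (iter v ∂y P)

  linComb : (n : ℕ) → (Fin n → Carrier) → (Fin n → Poly) → Poly
  linComb n μ F i j = sumFin n (λ m → μ m * F m i j)

  -- the linear span of the finite family F is one-dimensional: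
  -- it equals K·G for some nonzero G, i.e. G is in the span and every
  -- generator is a scalar multiple of G
  SpanOneDim : (n : ℕ) → (Fin n → Poly) → Set (c ⊔ ℓ)
  SpanOneDim n F =
    Σ Poly λ G → NonZeroP G
      × (∃ λ (μ : Fin n → Carrier) → G ≋ linComb n μ F)
      × (∀ m → ∃ λ (λ' : Carrier) → F m ≋ scale λ' G)

  Degenerate : ℕ → Poly → Set (c ⊔ ℓ)
  Degenerate k Φ = ∃ λ (α : Carrier) → ∃ λ (β : Carrier) → Φ ≋ powP (linear α β) k

-- Integer binary forms of degree k: coefficient functions ℕ → ℕ → ℤ,
-- homogeneous of degree k and nonzero (so deg Φ = k).

IntPoly : Set
IntPoly = ℕ → ℕ → ℤ

IsBinaryFormOfDegree : ℕ → IntPoly → Set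
IsBinaryFormOfDegree k Φ =
  (∀ i j → ¬ (i ℕ.+ j ≡ k) → Φ i j ≡ + 0)
  × (∃ λ i → ∃ λ j → ¬ (Φ i j ≡ + 0))

toK : ∀ {c ℓ} (K : AlgClosedChar0 c ℓ) → IntPoly →
      ℕ → ℕ → CommutativeRing.Carrier (AlgClosedChar0.ring K)
toK K Φ i j = FieldOps.fromℤ (AlgClosedChar0.ring K) (Φ i j)

derivFamily : ∀ {c ℓ} (K : AlgClosedChar0 c ℓ) → IntPoly → (l : ℕ) →
              Fin (suc l) → Poly.Poly (AlgClosedChar0.ring K)
derivFamily K Φ l u = Poly.deriv (AlgClosedChar0.ring K) (toℕ u) (l ∸ toℕ u) (toK K Φ)

module Submission where

-- Work with normalised coefficients  nc P i j = P_{ij} · i! · j!, in which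
-- differentiation is a shift (nc-deriv) and (αx + βy)^k has diagonal entries
-- k! α^i β^(k-i) (Binomial.binomial).  For b n = nc Φ n (k - n), the
-- coefficient of x^i y^(m-i) in Φ^{u,l-u} is b (i + u) up to the factor
-- i!(m-i)!, so "every Φ^{u,l-u} is a multiple of one G" makes the Hankel
-- matrix (b (i + u)) of rank one (rankOne⇒hankel).  Such a sequence is
-- geometric when b 0 ≠ 0 and vanishes below k when b 0 = 0; taking a k-th
-- root it has the shape n ↦ k! α^n β^(k-n) (Hankel.binomialShape).  Comparing
-- coefficients with (αx + βy)^k (forms-agree) proves the theorem.

open import Defs
open import Level using (Level)
open import Data.Nat as ℕ using (ℕ; zero; suc; _≤_; _<_; z≤n; s≤s)
import Data.Nat.Properties as ℕP
open import Data.Nat.Induction using (<-rec)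
open import Data.Integer using (+_; -[1+_]) renaming (_≟_ to _≟ℤ_)
open import Data.Fin using (Fin; toℕ; fromℕ<)
import Data.Fin.Properties as FinP
open import Data.Product using (∃; ∃₂; _×_; _,_)
open import Data.Sum using (inj₁; inj₂)
open import Data.Empty using (⊥-elim)
open import Relation.Nullary using (¬_; Dec; yes; no)
open import Relation.Binary.PropositionalEquality as ≡ using (_≡_; refl; cong; subst)
open import Algebra.Bundles using (CommutativeRing)
open import Algebra.Properties.CommutativeSemigroup ℕP.+-commutativeSemigroup
  using (interchange)

split : ∀ a b n → n ≤ a ℕ.+ b → ∃₂ λ i u → i ≤ a × u ≤ b × i ℕ.+ u ≡ n
split zero    b n       n≤b     = 0 , n , z≤n , n≤b , refl
split (suc a) b zero    _       = 0 , 0 , z≤n , z≤n , refl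
split (suc a) b (suc n) (s≤s h) with split a b n h
... | i , u , i≤a , u≤b , refl = suc i , u , s≤s i≤a , u≤b , refl

splitPositive : ∀ {a b} n → 1 ≤ a → 1 ≤ b → suc (suc n) ≤ a ℕ.+ b →
                ∃₂ λ i u → suc i ≤ a × suc u ≤ b × i ℕ.+ u ≡ n
splitPositive {suc a} {suc b} n (s≤s z≤n) (s≤s z≤n) (s≤s h)
  with split a b n (ℕP.≤-pred (subst (suc n ≤_) (ℕP.+-suc a b) h))
... | i , u , i≤a , u≤b , i+u≡n = i , u , s≤s i≤a , s≤s u≤b , i+u≡n

module Theory {c ℓ : Level} (K : AlgClosedChar0 c ℓ) where
  open AlgClosedChar0 K using (inverse; char0; algClosed) renaming (ring to R)
  open CommutativeRing R hiding (zero)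
    renaming (refl to ≈-refl; sym to ≈-sym; trans to ≈-trans)
  open Poly R
  open import Algebra.Properties.Ring (CommutativeRing.ring R) using (-0#≈0#; -‿involutive)
  open import Relation.Binary.Reasoning.Setoid setoid
  open import Algebra.Solver.Ring.NaturalCoefficients.Default commutativeSemiring
    using (solve; _:+_; _:*_; _:=_; con)

  cancelʳ : ∀ {x y z} → ¬ (z ≈ 0#) → x * z ≈ y * z → x ≈ y
  cancelʳ {x} {y} {z} z≉0 xz≈yz with inverse z z≉0
  ... | z⁻¹ , zz⁻¹≈1 = begin
    x               ≈⟨ ≈-sym (*-identityʳ x) ⟩
    x * 1#          ≈⟨ *-congˡ (≈-sym zz⁻¹≈1) ⟩
    x * (z * z⁻¹)   ≈⟨ ≈-sym (*-assoc x z z⁻¹) ⟩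
    (x * z) * z⁻¹   ≈⟨ *-congʳ xz≈yz ⟩
    (y * z) * z⁻¹   ≈⟨ *-assoc y z z⁻¹ ⟩
    y * (z * z⁻¹)   ≈⟨ *-congˡ zz⁻¹≈1 ⟩
    y * 1#          ≈⟨ *-identityʳ y ⟩
    y               ∎

  nonzero-* : ∀ {x y} → ¬ (x ≈ 0#) → ¬ (y ≈ 0#) → ¬ (x * y ≈ 0#)
  nonzero-* {x} {y} x≉0 y≉0 xy≈0 =
    y≉0 (cancelʳ x≉0 (≈-trans (*-comm y x) (≈-trans xy≈0 (≈-sym (zeroˡ x)))))

  dec-≈0-* : ∀ {x c} → ¬ (c ≈ 0#) → Dec (x ≈ 0#) → Dec (x * c ≈ 0#)
  dec-≈0-* c≉0 (yes x≈0) = yes (≈-trans (*-congʳ x≈0) (zeroˡ _))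
  dec-≈0-* c≉0 (no x≉0)  = no (nonzero-* x≉0 c≉0)

  fromℕ-+ : ∀ a b → fromℕ (a ℕ.+ b) ≈ fromℕ a + fromℕ b
  fromℕ-+ zero    b = ≈-sym (+-identityˡ _)
  fromℕ-+ (suc a) b = ≈-trans (+-congˡ (fromℕ-+ a b)) (≈-sym (+-assoc _ _ _))

  fact : ℕ → Carrier
  fact zero    = 1#
  fact (suc n) = fromℕ (suc n) * fact n

  1≉0 : ¬ (1# ≈ 0#)
  1≉0 1≈0 = char0 0 (≈-trans (+-identityʳ 1#) 1≈0)

  fact≉0 : ∀ n → ¬ (fact n ≈ 0#)
  fact≉0 zero    = 1≉0
  fact≉0 (suc n) = nonzero-* (char0 n) (fact≉0 n)

  fromℤ≉0 : ∀ z → ¬ (z ≡ + 0) → ¬ (fromℤ z ≈ 0#)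
  fromℤ≉0 (+ zero)  z≢0 _    = z≢0 refl
  fromℤ≉0 (+ suc n) _   n≈0  = char0 n n≈0
  fromℤ≉0 -[1+ n ]  _   -n≈0 =
    char0 n (≈-trans (≈-sym (-‿involutive _)) (≈-trans (-‿cong -n≈0) -0#≈0#))

  dec-fromℤ≈0 : ∀ z → Dec (fromℤ z ≈ 0#)
  dec-fromℤ≈0 z with z ≟ℤ + 0
  ... | yes refl = yes ≈-refl
  ... | no z≢0   = no (fromℤ≉0 z z≢0)

  pow-+ : ∀ x a b → pow x (a ℕ.+ b) ≈ pow x a * pow x b
  pow-+ x zero    b = ≈-sym (*-identityˡ _)
  pow-+ x (suc a) b = ≈-trans (*-congˡ (pow-+ x a b)) (≈-sym (*-assoc _ _ _))

  pow-split : ∀ x {n k} → n ≤ k → pow x k ≈ pow x n * pow x (k ℕ.∸ n)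
  pow-split x {n} {k} n≤k =
    ≈-trans (reflexive (cong (pow x) (≡.sym (ℕP.m+[n∸m]≡n n≤k)))) (pow-+ x n (k ℕ.∸ n))

  pow-* : ∀ x y n → pow (x * y) n ≈ pow x n * pow y n
  pow-* x y zero    = ≈-sym (*-identityˡ 1#)
  pow-* x y (suc n) = ≈-trans (*-congˡ (pow-* x y n))
    (solve 4 (λ x y a b → (x :* y) :* (a :* b) := (x :* a) :* (y :* b)) ≈-refl x y (pow x n) (pow y n))

  pow-0# : ∀ n → 0 < n → pow 0# n ≈ 0#
  pow-0# (suc n) _ = zeroˡ _

  sumTo-zero : ∀ n (f : ℕ → Carrier) → (∀ a → f a ≈ 0#) → sumTo n f ≈ 0#
  sumTo-zero zero    f f≈0 = f≈0 zero
  sumTo-zero (suc n) f f≈0 = ≈-trans (+-cong (sumTo-zero n f f≈0) (f≈0 (suc n))) (+-identityʳ 0#)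

  sumTo-head : ∀ n (f : ℕ → Carrier) → (∀ a → f (suc a) ≈ 0#) → sumTo n f ≈ f zero
  sumTo-head zero    f tail≈0 = ≈-refl
  sumTo-head (suc n) f tail≈0 = ≈-trans (+-cong (sumTo-head n f tail≈0) (tail≈0 n)) (+-identityʳ _)

  sumTo-shift : ∀ n (f : ℕ → Carrier) → sumTo (suc n) f ≈ f zero + sumTo n (λ a → f (suc a))
  sumTo-shift zero    f = ≈-refl
  sumTo-shift (suc n) f = ≈-trans (+-congʳ (sumTo-shift n f)) (+-assoc _ _ _)

  sumFin-zero : ∀ n (f : Fin n → Carrier) → (∀ i → f i ≈ 0#) → sumFin n f ≈ 0#
  sumFin-zero zero    f f≈0 = ≈-refl
  sumFin-zero (suc n) f f≈0 =
    ≈-trans (+-cong (f≈0 Fin.zero) (sumFin-zero n _ (λ i → f≈0 (Fin.suc i)))) (+-identityʳ 0#)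
    where import Data.Fin as Fin

  -- Algebraic closedness applied to z^(n+1) - x.
  root : ∀ n x → ∃ λ z → pow z (suc n) ≈ x
  root n x with algClosed n coeffs
    where
      coeffs : Fin (suc n) → Carrier
      coeffs Fin.zero    = - x
      coeffs (Fin.suc _) = 0#
      import Data.Fin as Fin
  ... | z , isRoot = z , (begin
    zⁿ⁺¹                  ≈⟨ ≈-sym (+-identityʳ zⁿ⁺¹) ⟩
    zⁿ⁺¹ + 0#             ≈⟨ +-congˡ (≈-sym (-‿inverseˡ x)) ⟩
    zⁿ⁺¹ + (- x + x)      ≈⟨ ≈-sym (+-assoc _ _ _) ⟩
    (zⁿ⁺¹ + - x) + x      ≈⟨ +-congʳ (≈-trans (+-congˡ (≈-sym lowerTerms)) isRoot) ⟩
    0# + x                ≈⟨ +-identityˡ x ⟩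
    x                     ∎)
    where
      zⁿ⁺¹ = pow z (suc n)
      lowerTerms = ≈-trans (+-congˡ (sumFin-zero n _ (λ _ → zeroˡ _)))
                           (≈-trans (+-identityʳ _) (*-identityʳ _))

  scaledRoot : ∀ {k} c x → ¬ (c ≈ 0#) → 1 ≤ k → ∃ λ z → c * pow z k ≈ x
  scaledRoot {suc k} c x c≉0 _ with inverse c c≉0
  ... | c⁻¹ , cc⁻¹≈1 with root k (c⁻¹ * x)
  ... | z , zᵏ≈c⁻¹x = z , (begin
    c * pow z (suc k)  ≈⟨ *-congˡ zᵏ≈c⁻¹x ⟩
    c * (c⁻¹ * x)      ≈⟨ ≈-sym (*-assoc c c⁻¹ x) ⟩
    (c * c⁻¹) * x      ≈⟨ *-congʳ cc⁻¹≈1 ⟩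
    1# * x             ≈⟨ *-identityˡ x ⟩
    x                  ∎)

  nc : Poly → ℕ → ℕ → Carrier
  nc P i j = P i j * (fact i * fact j)

  diagonal : Poly → ℕ → ℕ → Carrier
  diagonal P k n = nc P n (k ℕ.∸ n)

  diagonal-at : ∀ (P : Poly) {k} i j → i ℕ.+ j ≡ k → nc P i j ≈ diagonal P k i
  diagonal-at P i j refl = reflexive (cong (λ t → P i t * (fact i * fact t)) (≡.sym (ℕP.m+n∸m≡n i j)))

  -- Two polynomials vanishing off the diagonal i + j = k with equal diagonal
  -- normalised coefficients are equal (factorials are invertible).
  forms-agree : ∀ {P Q} k →
    (∀ i j → ¬ (i ℕ.+ j ≡ k) → P i j ≈ 0#) →
    (∀ i j → ¬ (i ℕ.+ j ≡ k) → Q i j ≈ 0#) →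
    (∀ n → n ≤ k → diagonal P k n ≈ diagonal Q k n) → P ≋ Q
  forms-agree {P} {Q} k P-off Q-off same i j with i ℕ.+ j ℕ.≟ k
  ... | no  off = ≈-trans (P-off i j off) (≈-sym (Q-off i j off))
  ... | yes on  = cancelʳ (nonzero-* (fact≉0 i) (fact≉0 j)) (begin
    nc P i j          ≈⟨ diagonal-at P i j on ⟩
    diagonal P k i    ≈⟨ same i (subst (i ≤_) on (ℕP.m≤m+n i j)) ⟩
    diagonal Q k i    ≈⟨ ≈-sym (diagonal-at Q i j on) ⟩
    nc Q i j          ∎)

  module Binomial (α β : Carrier) where
    L : Poly
    L = linear α β

    timesL : Poly → Poly
    timesL P zero    zero    = 0#
    timesL P zero    (suc j) = β * P zero j
    timesL P (suc i) zero    = α * P i zero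
    timesL P (suc i) (suc j) = β * P (suc i) j + α * P i (suc j)

    yPart : Poly → Poly
    yPart P i zero    = 0#
    yPart P i (suc j) = β * P i j

    yPart-conv : ∀ (P : Poly) i j → sumTo j (λ b → L 0 b * P i (j ℕ.∸ b)) ≈ yPart P i j
    yPart-conv P i zero    = zeroˡ _
    yPart-conv P i (suc j) = ≈-trans (sumTo-shift j _)
      (≈-trans (+-cong (zeroˡ _) (sumTo-head j _ (λ _ → zeroˡ _))) (+-identityˡ _))

    xPart-conv : ∀ (P : Poly) i j → sumTo j (λ b → L 1 b * P i (j ℕ.∸ b)) ≈ α * P i j
    xPart-conv P i j = sumTo-head j _ (λ _ → zeroˡ _)

    conv-suc : ∀ (P : Poly) i j → (L *P P) (suc i) j ≈ yPart P (suc i) j + α * P i j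
    conv-suc P i j = ≈-trans (sumTo-shift i _)
      (+-cong (yPart-conv P (suc i) j)
              (≈-trans (sumTo-head i _ (λ _ → sumTo-zero j _ (λ _ → zeroˡ _))) (xPart-conv P i j)))

    conv : ∀ (P : Poly) i j → (L *P P) i j ≈ timesL P i j
    conv P zero    zero    = yPart-conv P zero zero
    conv P zero    (suc j) = yPart-conv P zero (suc j)
    conv P (suc i) zero    = ≈-trans (conv-suc P i zero) (+-identityˡ _)
    conv P (suc i) (suc j) = conv-suc P i (suc j)

    binomial-off : ∀ n i j → ¬ (i ℕ.+ j ≡ n) → powP L n i j ≈ 0#
    binomial-off zero    zero    zero    off = ⊥-elim (off refl)
    binomial-off zero    zero    (suc j) off = ≈-refl
    binomial-off zero    (suc i) j       off = ≈-refl
    binomial-off (suc n) zero    zero    off = conv (powP L n) zero zero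
    binomial-off (suc n) zero    (suc j) off = ≈-trans (conv (powP L n) zero (suc j))
      (≈-trans (*-congˡ (binomial-off n zero j (λ e → off (cong suc e)))) (zeroʳ β))
    binomial-off (suc n) (suc i) zero    off = ≈-trans (conv (powP L n) (suc i) zero)
      (≈-trans (*-congˡ (binomial-off n i zero (λ e → off (cong suc e)))) (zeroʳ α))
    binomial-off (suc n) (suc i) (suc j) off = ≈-trans (conv (powP L n) (suc i) (suc j))
      (≈-trans (+-cong (≈-trans (*-congˡ (binomial-off n (suc i) j
                          (λ e → off (cong suc (≡.trans (ℕP.+-suc i j) e))))) (zeroʳ β))
                       (≈-trans (*-congˡ (binomial-off n i (suc j) (λ e → off (cong suc e)))) (zeroʳ α)))
               (+-identityʳ 0#))

    binomial-edgeʸ : ∀ j → nc (powP L j) 0 j ≈ fact j * (1# * pow β j) →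
                     nc (powP L (suc j)) 0 (suc j) ≈ fact (suc j) * (1# * pow β (suc j))
    binomial-edgeʸ j ih = begin
      powP L (suc j) 0 (suc j) * (1# * (s * fj))  ≈⟨ *-congʳ (conv (powP L j) zero (suc j)) ⟩
      (β * Q) * (1# * (s * fj))
        ≈⟨ solve 4 (λ β Q s fj → (β :* Q) :* (con 1 :* (s :* fj)) := (β :* s) :* (Q :* (con 1 :* fj))) ≈-refl β Q s fj ⟩
      (β * s) * (Q * (1# * fj))                   ≈⟨ *-congˡ ih ⟩
      (β * s) * (fj * (1# * pow β j))
        ≈⟨ solve 4 (λ β bj s fj → (β :* s) :* (fj :* (con 1 :* bj)) := (s :* fj) :* (con 1 :* (β :* bj))) ≈-refl β (pow β j) s fj ⟩
      (s * fj) * (1# * (β * pow β j))             ∎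
      where
        Q = powP L j 0 j
        s = fromℕ (suc j)
        fj = fact j

    binomial-edgeˣ : ∀ i → nc (powP L i) i 0 ≈ fact i * (pow α i * 1#) →
                     nc (powP L (suc i)) (suc i) 0 ≈ fact (suc i) * (pow α (suc i) * 1#)
    binomial-edgeˣ i ih = begin
      powP L (suc i) (suc i) 0 * ((s * fi) * 1#)  ≈⟨ *-congʳ (conv (powP L i) (suc i) zero) ⟩
      (α * Q) * ((s * fi) * 1#)
        ≈⟨ solve 4 (λ α Q s fi → (α :* Q) :* ((s :* fi) :* con 1) := (α :* s) :* (Q :* (fi :* con 1))) ≈-refl α Q s fi ⟩
      (α * s) * (Q * (fi * 1#))                   ≈⟨ *-congˡ ih ⟩
      (α * s) * (fi * (pow α i * 1#))
        ≈⟨ solve 4 (λ α ai s fi → (α :* s) :* (fi :* (ai :* con 1)) := (s :* fi) :* ((α :* ai) :* con 1)) ≈-refl α (pow α i) s fi ⟩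
      (s * fi) * ((α * pow α i) * 1#)             ∎
      where
        Q = powP L i i 0
        s = fromℕ (suc i)
        fi = fact i

    -- Interior step: Pascal's rule (i+1) + (j+1) = n + 1 in normalised form.
    binomial-interior : ∀ n i j → suc i ℕ.+ suc j ≡ suc n →
      nc (powP L n) (suc i) j ≈ fact n * (pow α (suc i) * pow β j) →
      nc (powP L n) i (suc j) ≈ fact n * (pow α i * pow β (suc j)) →
      nc (powP L (suc n)) (suc i) (suc j) ≈ fact (suc n) * (pow α (suc i) * pow β (suc j))
    binomial-interior n i j e ihˣ ihʸ = begin
      powP L (suc n) (suc i) (suc j) * ((si * fi) * (sj * fj))
        ≈⟨ *-congʳ (conv (powP L n) (suc i) (suc j)) ⟩
      (β * Y + α * X) * ((si * fi) * (sj * fj))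
        ≈⟨ solve 8 (λ α β Y X si fi sj fj → (β :* Y :+ α :* X) :* ((si :* fi) :* (sj :* fj))
                      := (β :* sj) :* (Y :* ((si :* fi) :* fj)) :+ (α :* si) :* (X :* (fi :* (sj :* fj))))
                   ≈-refl α β Y X si fi sj fj ⟩
      (β * sj) * (Y * ((si * fi) * fj)) + (α * si) * (X * (fi * (sj * fj)))
        ≈⟨ +-cong (*-congˡ ihˣ) (*-congˡ ihʸ) ⟩
      (β * sj) * (fn * ((α * ai) * bj)) + (α * si) * (fn * (ai * (β * bj)))
        ≈⟨ solve 7 (λ α β ai bj si sj fn → (β :* sj) :* (fn :* ((α :* ai) :* bj)) :+ (α :* si) :* (fn :* (ai :* (β :* bj)))
                      := ((si :+ sj) :* fn) :* ((α :* ai) :* (β :* bj)))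
                   ≈-refl α β ai bj si sj fn ⟩
      ((si + sj) * fn) * ((α * ai) * (β * bj))
        ≈⟨ *-congʳ (*-congʳ (≈-sym (≈-trans (reflexive (cong fromℕ (≡.sym e))) (fromℕ-+ (suc i) (suc j))))) ⟩
      (fromℕ (suc n) * fn) * ((α * ai) * (β * bj)) ∎
      where
        Y = powP L n (suc i) j
        X = powP L n i (suc j)
        si = fromℕ (suc i)
        sj = fromℕ (suc j)
        fi = fact i
        fj = fact j
        fn = fact n
        ai = pow α i
        bj = pow β j

    binomial : ∀ n i j → i ℕ.+ j ≡ n → nc (powP L n) i j ≈ fact n * (pow α i * pow β j)
    binomial zero    zero    zero    refl = ≈-refl
    binomial (suc n) zero    (suc j) e with ℕP.suc-injective e
    ... | refl = binomial-edgeʸ j (binomial j zero j refl)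
    binomial (suc n) (suc i) zero    e with ≡.trans (≡.sym (ℕP.+-identityʳ i)) (ℕP.suc-injective e)
    ... | refl = binomial-edgeˣ i (binomial i i zero (ℕP.+-identityʳ i))
    binomial (suc n) (suc i) (suc j) e = binomial-interior n i j e
      (binomial n (suc i) j (≡.trans (≡.sym (ℕP.+-suc i j)) (ℕP.suc-injective e)))
      (binomial n i (suc j) (ℕP.suc-injective e))

    binomial-diagonal : ∀ k n → n ≤ k → diagonal (powP L k) k n ≈ fact k * (pow α n * pow β (k ℕ.∸ n))
    binomial-diagonal k n n≤k = binomial k n (k ℕ.∸ n) (ℕP.m+[n∸m]≡n n≤k)

  -- Derivatives act on normalised coefficients by shifting.

  -- (i+1)(i+2)⋯(i+u), the factor produced by u derivatives at x^i
  rising : ℕ → ℕ → Carrier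
  rising i zero    = 1#
  rising i (suc u) = fromℕ (suc i) * rising (suc i) u

  rising-fact : ∀ u i → rising i u * fact i ≈ fact (i ℕ.+ u)
  rising-fact zero    i = ≈-trans (*-identityˡ _) (reflexive (cong fact (≡.sym (ℕP.+-identityʳ i))))
  rising-fact (suc u) i =
    ≈-trans (solve 3 (λ s f g → (s :* f) :* g := f :* (s :* g)) ≈-refl (fromℕ (suc i)) (rising (suc i) u) (fact i))
            (≈-trans (rising-fact u (suc i)) (reflexive (cong fact (≡.sym (ℕP.+-suc i u)))))

  iter-∂x : ∀ u (P : Poly) i j → iter u ∂x P i j ≈ rising i u * P (i ℕ.+ u) j
  iter-∂x zero    P i j = ≈-trans (reflexive (cong (λ t → P t j) (≡.sym (ℕP.+-identityʳ i)))) (≈-sym (*-identityˡ _))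
  iter-∂x (suc u) P i j = ≈-trans (*-congˡ (iter-∂x u P (suc i) j))
    (≈-trans (≈-sym (*-assoc _ _ _)) (*-congˡ (reflexive (cong (λ t → P t j) (≡.sym (ℕP.+-suc i u))))))

  iter-∂y : ∀ v (P : Poly) i j → iter v ∂y P i j ≈ rising j v * P i (j ℕ.+ v)
  iter-∂y zero    P i j = ≈-trans (reflexive (cong (P i) (≡.sym (ℕP.+-identityʳ j)))) (≈-sym (*-identityˡ _))
  iter-∂y (suc v) P i j = ≈-trans (*-congˡ (iter-∂y v P i (suc j)))
    (≈-trans (≈-sym (*-assoc _ _ _)) (*-congˡ (reflexive (cong (P i) (≡.sym (ℕP.+-suc j v))))))

  nc-deriv : ∀ u v (P : Poly) i j → nc (deriv u v P) i j ≈ nc P (i ℕ.+ u) (j ℕ.+ v)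
  nc-deriv u v P i j = begin
    deriv u v P i j * (fact i * fact j)
      ≈⟨ *-congʳ (≈-trans (iter-∂x u (iter v ∂y P) i j) (*-congˡ (iter-∂y v P (i ℕ.+ u) j))) ⟩
    (rising i u * (rising j v * X)) * (fact i * fact j)
      ≈⟨ solve 5 (λ a b x c d → (a :* (b :* x)) :* (c :* d) := x :* ((a :* c) :* (b :* d)))
                 ≈-refl (rising i u) (rising j v) X (fact i) (fact j) ⟩
    X * ((rising i u * fact i) * (rising j v * fact j))
      ≈⟨ *-congˡ (*-cong (rising-fact u i) (rising-fact v j)) ⟩
    X * (fact (i ℕ.+ u) * fact (j ℕ.+ v)) ∎
    where X = P (i ℕ.+ u) (j ℕ.+ v)

  deriv-diagonal : ∀ (P : Poly) m l u i → u ≤ l → i ≤ m →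
    nc (deriv u (l ℕ.∸ u) P) i (m ℕ.∸ i) ≈ diagonal P (m ℕ.+ l) (i ℕ.+ u)
  deriv-diagonal P m l u i u≤l i≤m =
    ≈-trans (nc-deriv u (l ℕ.∸ u) P i (m ℕ.∸ i))
      (diagonal-at P (i ℕ.+ u) ((m ℕ.∸ i) ℕ.+ (l ℕ.∸ u))
        (≡.trans (interchange i u (m ℕ.∸ i) (l ℕ.∸ u))
                 (≡.cong₂ ℕ._+_ (ℕP.m+[n∸m]≡n i≤m) (ℕP.m+[n∸m]≡n u≤l))))

  multiples⇒minor : ∀ {n} (F : Fin n → Poly) (G : Poly) → (∀ U → ∃ λ a → F U ≋ scale a G) →
    ∀ U U' p₁ p₂ q₁ q₂ → nc (F U) p₁ p₂ * nc (F U') q₁ q₂ ≈ nc (F U) q₁ q₂ * nc (F U') p₁ p₂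
  multiples⇒minor F G multiple U U' p₁ p₂ q₁ q₂ with multiple U | multiple U'
  ... | a , F≈aG | a' , F'≈a'G = begin
    nc (F U) p₁ p₂ * nc (F U') q₁ q₂
      ≈⟨ *-cong (*-congʳ (F≈aG p₁ p₂)) (*-congʳ (F'≈a'G q₁ q₂)) ⟩
    ((a * g₁) * w₁) * ((a' * g₂) * w₂)
      ≈⟨ solve 6 (λ a a' g₁ g₂ w₁ w₂ → ((a :* g₁) :* w₁) :* ((a' :* g₂) :* w₂)
                    := ((a :* g₂) :* w₂) :* ((a' :* g₁) :* w₁)) ≈-refl a a' g₁ g₂ w₁ w₂ ⟩
    ((a * g₂) * w₂) * ((a' * g₁) * w₁)
      ≈⟨ ≈-sym (*-cong (*-congʳ (F≈aG q₁ q₂)) (*-congʳ (F'≈a'G p₁ p₂))) ⟩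
    nc (F U) q₁ q₂ * nc (F U') p₁ p₂ ∎
    where
      g₁ = G p₁ p₂
      g₂ = G q₁ q₂
      w₁ = fact p₁ * fact p₂
      w₂ = fact q₁ * fact q₂

  -- Hankel sequences of rank one

  HankelRankOne : (ℕ → Carrier) → ℕ → ℕ → Set ℓ
  HankelRankOne b l m = ∀ u u' i i' → u ≤ l → u' ≤ l → i ≤ m → i' ≤ m →
    b (i ℕ.+ u) * b (i' ℕ.+ u') ≈ b (i' ℕ.+ u) * b (i ℕ.+ u')

  rankOne⇒hankel : ∀ (P : Poly) m l (G : Poly) →
    (∀ (U : Fin (suc l)) → ∃ λ a → deriv (toℕ U) (l ℕ.∸ toℕ U) P ≋ scale a G) →
    HankelRankOne (diagonal P (m ℕ.+ l)) l m
  rankOne⇒hankel P m l G multiple u u' i i' u≤l u'≤l i≤m i'≤m = begin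
    d (i ℕ.+ u) * d (i' ℕ.+ u')    ≈⟨ ≈-sym (*-cong (at u i u≤l i≤m) (at u' i' u'≤l i'≤m)) ⟩
    nc (F U) i (m ℕ.∸ i) * nc (F U') i' (m ℕ.∸ i')
      ≈⟨ multiples⇒minor F G multiple U U' i (m ℕ.∸ i) i' (m ℕ.∸ i') ⟩
    nc (F U) i' (m ℕ.∸ i') * nc (F U') i (m ℕ.∸ i)
      ≈⟨ *-cong (at u i' u≤l i'≤m) (at u' i u'≤l i≤m) ⟩
    d (i' ℕ.+ u) * d (i ℕ.+ u')    ∎
    where
      d = diagonal P (m ℕ.+ l)
      F : Fin (suc l) → Poly
      F V = deriv (toℕ V) (l ℕ.∸ toℕ V) P
      index : ∀ w → w ≤ l → Fin (suc l)
      index w w≤l = fromℕ< (s≤s w≤l)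
      U = index u u≤l
      U' = index u' u'≤l
      at : ∀ w j (w≤l : w ≤ l) → j ≤ m → nc (F (index w w≤l)) j (m ℕ.∸ j) ≈ d (j ℕ.+ w)
      at w j w≤l j≤m rewrite FinP.toℕ-fromℕ< (s≤s w≤l) = deriv-diagonal P m l w j w≤l j≤m

  -- A sequence with rank-one Hankel matrix, l, m ≥ 1.  Zero tests on b are
  -- assumed decidable: constructively this is what lets us split on b 0 = 0.
  module Hankel (b : ℕ → Carrier) (l m : ℕ) (1≤l : 1 ≤ l) (1≤m : 1 ≤ m)
                (hankel : HankelRankOne b l m) (zero? : ∀ n → Dec (b n ≈ 0#)) where

    k : ℕ
    k = m ℕ.+ l

    b-cong : ∀ {p q} → p ≡ q → b p ≈ b q
    b-cong p≡q = reflexive (cong b p≡q)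

    consecutive : ∀ p → suc (suc p) ≤ k → b (suc p) * b (suc p) ≈ b p * b (suc (suc p))
    consecutive p h with splitPositive p 1≤m 1≤l h
    ... | i , u , i<m , u<l , refl =
      ≈-trans (*-congˡ (b-cong (≡.sym (ℕP.+-suc i u))))
        (≈-trans (hankel u (suc u) (suc i) i (ℕP.<⇒≤ u<l) u<l i<m (ℕP.<⇒≤ i<m))
                 (*-congˡ (b-cong (cong suc (ℕP.+-suc i u)))))

    -- If b starts with 0 then it vanishes below k (b k may be anything).
    vanishes : b 0 ≈ 0# → ∀ p → p < k → b p ≈ 0#
    vanishes b0≈0 zero    _ = b0≈0
    vanishes b0≈0 (suc p) h with zero? (suc p)
    ... | yes bp≈0 = bp≈0
    ... | no  bp≉0 = ⊥-elim (nonzero-* bp≉0 bp≉0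
      (≈-trans (consecutive p h) (≈-trans (*-congʳ (vanishes b0≈0 p (ℕP.<⇒≤ h))) (zeroˡ _))))

    module Geometric (b0⁻¹ : Carrier) (b0b0⁻¹≈1 : b 0 * b0⁻¹ ≈ 1#) (b0≉0 : ¬ (b 0 ≈ 0#)) where
      r : Carrier
      r = b 1 * b0⁻¹

      -- b (j + u) · b 0 = b u · b j, so the geometric law propagates to sums.
      product-rule : ∀ j u → j ≤ m → u ≤ l →
        b j ≈ b 0 * pow r j → b u ≈ b 0 * pow r u → b (j ℕ.+ u) ≈ b 0 * pow r (j ℕ.+ u)
      product-rule j u j≤m u≤l bj bu = cancelʳ b0≉0 (begin
        b (j ℕ.+ u) * b 0  ≈⟨ hankel u 0 j 0 u≤l z≤n j≤m z≤n ⟩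
        b u * b (j ℕ.+ 0)  ≈⟨ *-congˡ (b-cong (ℕP.+-identityʳ j)) ⟩
        b u * b j          ≈⟨ *-cong bu bj ⟩
        (b 0 * pow r u) * (b 0 * pow r j)
          ≈⟨ solve 3 (λ a x y → (a :* x) :* (a :* y) := (a :* (y :* x)) :* a) ≈-refl (b 0) (pow r u) (pow r j) ⟩
        (b 0 * (pow r j * pow r u)) * b 0  ≈⟨ *-congʳ (*-congˡ (≈-sym (pow-+ r j u))) ⟩
        (b 0 * pow r (j ℕ.+ u)) * b 0      ∎)

      first : b 1 ≈ b 0 * pow r 1
      first = begin
        b 1               ≈⟨ ≈-sym (*-identityʳ _) ⟩
        b 1 * 1#          ≈⟨ *-congˡ (≈-sym b0b0⁻¹≈1) ⟩
        b 1 * (b 0 * b0⁻¹) ≈⟨ solve 3 (λ x y d → x :* (y :* d) := y :* ((x :* d) :* con 1)) ≈-refl (b 1) (b 0) b0⁻¹ ⟩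
        b 0 * (r * 1#)    ∎

      -- Strong induction: n ≥ 2 splits as j + u with 1 ≤ j ≤ m, 1 ≤ u ≤ l.
      geometric : ∀ n → n ≤ k → b n ≈ b 0 * pow r n
      geometric = <-rec (λ n → n ≤ k → b n ≈ b 0 * pow r n) step
        where
          step : ∀ n → (∀ {n'} → n' < n → n' ≤ k → b n' ≈ b 0 * pow r n') → n ≤ k → b n ≈ b 0 * pow r n
          step zero          _  _ = ≈-sym (*-identityʳ _)
          step (suc zero)    _  _ = first
          step (suc (suc t)) ih h with splitPositive t 1≤m 1≤l h
          ... | i , u , i<m , u<l , refl =
            ≈-trans (b-cong (≡.sym sum≡))
              (≈-trans (product-rule (suc i) (suc u) i<m u<l
                         (ih (s≤s (s≤s (ℕP.m≤m+n i u))) (ℕP.≤-trans i<m (ℕP.m≤m+n m l)))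
                         (ih (s≤s (s≤s (ℕP.m≤n+m u i))) (ℕP.≤-trans u<l (ℕP.m≤n+m l m))))
                       (*-congˡ (reflexive (cong (pow r) sum≡))))
            where
              sum≡ : suc i ℕ.+ suc u ≡ suc (suc (i ℕ.+ u))
              sum≡ = cong suc (ℕP.+-suc i u)

    binomialShape : ∀ c → ¬ (c ≈ 0#) →
      ∃₂ λ α β → ∀ n → n ≤ k → b n ≈ c * (pow α n * pow β (k ℕ.∸ n))
    binomialShape c c≉0 with zero? 0
    ... | no b0≉0 with inverse (b 0) b0≉0
    ... | b0⁻¹ , b0b0⁻¹≈1 with scaledRoot c (b 0) c≉0 (ℕP.≤-trans 1≤m (ℕP.m≤m+n m l))
    ... | z , czᵏ≈b0 = z * r , z , λ n n≤k → begin
      b n                                      ≈⟨ geometric n n≤k ⟩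
      b 0 * pow r n                            ≈⟨ *-congʳ (≈-sym czᵏ≈b0) ⟩
      (c * pow z k) * pow r n                  ≈⟨ *-congʳ (*-congˡ (pow-split z n≤k)) ⟩
      (c * (pow z n * pow z (k ℕ.∸ n))) * pow r n
        ≈⟨ solve 4 (λ c a b p → (c :* (a :* b)) :* p := c :* ((a :* p) :* b)) ≈-refl c (pow z n) (pow z (k ℕ.∸ n)) (pow r n) ⟩
      c * ((pow z n * pow r n) * pow z (k ℕ.∸ n)) ≈⟨ *-congˡ (*-congʳ (≈-sym (pow-* z r n))) ⟩
      c * (pow (z * r) n * pow z (k ℕ.∸ n))    ∎
      where open Geometric b0⁻¹ b0b0⁻¹≈1 b0≉0
    binomialShape c c≉0 | yes b0≈0 with scaledRoot c (b k) c≉0 (ℕP.≤-trans 1≤m (ℕP.m≤m+n m l))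
    ... | z , czᵏ≈bk = z , 0# , shape
      where
        shape : ∀ n → n ≤ k → b n ≈ c * (pow z n * pow 0# (k ℕ.∸ n))
        shape n n≤k with ℕP.m≤n⇒m<n∨m≡n n≤k
        ... | inj₁ n<k = ≈-trans (vanishes b0≈0 n n<k)
              (≈-sym (≈-trans (*-congˡ (≈-trans (*-congˡ (pow-0# (k ℕ.∸ n) (ℕP.m<n⇒0<n∸m n<k))) (zeroʳ _))) (zeroʳ _)))
        ... | inj₂ refl = ≈-trans (≈-sym czᵏ≈bk)
              (*-congˡ (≈-trans (≈-sym (*-identityʳ _)) (*-congˡ (reflexive (cong (pow 0#) (≡.sym (ℕP.n∸n≡0 k)))))))

  toK-off : ∀ (Φ : IntPoly) k → (∀ i j → ¬ (i ℕ.+ j ≡ k) → Φ i j ≡ + 0) →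
            ∀ i j → ¬ (i ℕ.+ j ≡ k) → toK K Φ i j ≈ 0#
  toK-off Φ k form i j off rewrite form i j off = ≈-refl

  degenerate-of-rankOne : ∀ (Φ : IntPoly) k l m → m ℕ.+ l ≡ k → 1 ≤ l → 1 ≤ m →
    (∀ i j → ¬ (i ℕ.+ j ≡ k) → Φ i j ≡ + 0) →
    (G : Poly) → (∀ U → ∃ λ a → derivFamily K Φ l U ≋ scale a G) →
    Degenerate k (toK K Φ)
  degenerate-of-rankOne Φ _ l m refl 1≤l 1≤m form G multiple
    with Hankel.binomialShape b l m 1≤l 1≤m (rankOne⇒hankel Φ' m l G multiple) zero? (fact k) (fact≉0 k)
    where
      Φ' = toK K Φ
      k = m ℕ.+ l
      b = diagonal Φ' k
      zero? : ∀ n → Dec (b n ≈ 0#)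
      zero? n = dec-≈0-* (nonzero-* (fact≉0 n) (fact≉0 (k ℕ.∸ n))) (dec-fromℤ≈0 (Φ n (k ℕ.∸ n)))
  ... | α , β , shape = α , β , forms-agree (m ℕ.+ l) (toK-off Φ (m ℕ.+ l) form) (binomial-off (m ℕ.+ l))
          (λ n n≤k → ≈-trans (shape n n≤k) (≈-sym (binomial-diagonal (m ℕ.+ l) n n≤k)))
    where open Binomial α β

lemma2p2 : ∀ {c ℓ : Level} (K : AlgClosedChar0 c ℓ) (k : ℕ) (Φ : IntPoly) →
    IsBinaryFormOfDegree k Φ →
    (l : ℕ) → 1 ≤ l → l < k →
    Poly.SpanOneDim (AlgClosedChar0.ring K) (suc l) (derivFamily K Φ l) →
    Poly.Degenerate (AlgClosedChar0.ring K) k (toK K Φ)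
lemma2p2 K k Φ (form , _) l 1≤l l<k (G , _ , _ , multiple) =
  Theory.degenerate-of-rankOne K Φ k l (k ℕ.∸ l)
    (ℕP.m∸n+n≡m (ℕP.<⇒≤ l<k)) 1≤l (ℕP.m<n⇒0<n∸m l<k) form G multiple
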